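{- There is an absolute constant $C>0$ such that the following holds. Let $G$ be a finite abelian group with $|G|=m$ and let $A\subseteq G$ satisfy $R_A(g)\le 7$ for all $g\in G$. Then $$|\{g\in G:\ R_A(g)=4\}|\ \le\ \frac{3}{4}m+C\sqrt{m}.$$
   Context: For a subset $A$ of an abelian group $G$ (written additively) and $g\in G$, $R_A(g)$ denotes the number of ordered pairs $(a,a')\in A\times A$ with $a+a'=g$. -}

module Defs where

open import Data.Nat using (ℕ; zero; suc; _+_; _*_)
open import Data.Bool using (Bool; true; false; if_then_else_; _∧_)
open import Data.Fin using (Fin; zero; suc; _≟_)
open import Data.Fin.Subset using (Subset)
open import Data.Vec using (lookup)
open import Relation.Nullary.Decidable using (⌊_⌋)
open import Algebra.Core using (Op₂)

count : ∀ {n} → (Fin n → Bool) → ℕ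
count {zero} f = 0
count {suc n} f = (if f zero then 1 else 0) + count (λ i → f (suc i))

sumFin : ∀ {n} → (Fin n → ℕ) → ℕ
sumFin {zero} f = 0
sumFin {suc n} f = f zero + sumFin (λ i → f (suc i))

R : ∀ {m} → Op₂ (Fin m) → Subset m → Fin m → ℕ
R _⊕_ A g = sumFin (λ a → count (λ a' → lookup A a ∧ lookup A a' ∧ ⌊ (a ⊕ a') ≟ g ⌋))

-- Write R = R_A and D(x) = #{(p, q) ∈ A² : p - q = x}. Both sum to |A|², and
-- Σ R(g)² = Σ D(x)² = E, the number of additive quadruples a + b = c + d in A.
-- Since every R(g) ∈ {0, …, 7} satisfies 12·[R(g) = 4] + R(g)² ≤ 7·R(g), we get
-- 12·#{R = 4} + E ≤ 7|A|². Conversely (D - 3)² ≥ 0 gives 6·D(x) ≤ D(x)² + 9 for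
-- x ≠ 0, while D(0) = |A|, so 7|A|² ≤ E + 9m + 6|A|. Hence 4·#{R = 4} ≤ 3m + 2|A|,
-- and |A|² = Σ R ≤ 7m turns this into (4·#{R = 4} - 3m)² ≤ 28m.
module Submission where

open import Defs
open import Level using (0ℓ)
open import Data.Nat using (ℕ; zero; suc; _+_; _*_; _∸_; _≤_; z≤n; s≤s)
import Data.Nat as N
open import Data.Nat.Properties
  using ( +-*-semiring; +-comm; +-identityʳ; *-assoc; *-comm; *-identityˡ; *-identityʳ
        ; ≤-reflexive; ≤-trans; m≤m+n; ≤ᵇ⇒≤; +-mono-≤; +-monoˡ-≤; +-cancelʳ-≤
        ; *-mono-≤; *-monoˡ-≤; *-monoʳ-≤; *-cancelˡ-≤; ∸-monoˡ-≤; m+n∸m≡n; module ≤-Reasoning)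
open import Data.Nat.Solver using (module +-*-Solver)
open import Data.Bool using (Bool; true; false; if_then_else_; _∧_)
open import Data.Fin using (Fin; zero; suc; _≟_)
open import Data.Fin.Properties using (suc-injective)
open import Data.Fin.Subset using (Subset)
open import Data.Vec using (lookup)
open import Data.Product using (Σ; _×_; _,_)
open import Data.Unit using (tt)
open import Function using (_∘_; _⇔_; mk⇔)
open import Function.Properties.Equivalence using (⇔-setoid)
open import Relation.Nullary.Decidable using (⌊_⌋; does; isYes≗does; does-⇔)
open import Relation.Binary.PropositionalEquality
  using (_≡_; refl; sym; trans; cong; cong₂; module ≡-Reasoning)
import Relation.Binary.Reasoning.Setoid as SetoidReasoning
open import Algebra.Core using (Op₁; Op₂)
open import Algebra.Bundles using (AbelianGroup)
open import Algebra.Structures using (IsAbelianGroup)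
open import Algebra.Properties.Semiring.Sum +-*-semiring
  using (sum; sum-syntax; ∑-comm; ∑-distrib-+; *-distribˡ-sum; *-distribʳ-sum; sum-replicate-zero)
  renaming (sum-cong-≗ to sum-cong)
import Algebra.Properties.AbelianGroup as AbelianGroupProperties
import Algebra.Properties.CommutativeSemigroup as CommutativeSemigroupProperties

𝟙 : Bool → ℕ
𝟙 b = if b then 1 else 0

𝟙-∧ : ∀ x y → 𝟙 (x ∧ y) ≡ 𝟙 x * 𝟙 y
𝟙-∧ true  y = sym (+-identityʳ (𝟙 y))
𝟙-∧ false y = refl

𝟙-idem : ∀ x → 𝟙 x * 𝟙 x ≡ 𝟙 x
𝟙-idem true  = refl
𝟙-idem false = refl

sumFin≡sum : ∀ {n} (f : Fin n → ℕ) → sumFin f ≡ sum f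
sumFin≡sum {zero}  f = refl
sumFin≡sum {suc n} f = cong (f zero +_) (sumFin≡sum (f ∘ suc))

count≡∑𝟙 : ∀ {n} (f : Fin n → Bool) → count f ≡ ∑[ i < n ] 𝟙 (f i)
count≡∑𝟙 {zero}  f = refl
count≡∑𝟙 {suc n} f = cong (𝟙 (f zero) +_) (count≡∑𝟙 (f ∘ suc))

∑-mono-≤ : ∀ {n} {f g : Fin n → ℕ} → (∀ i → f i ≤ g i) → sum f ≤ sum g
∑-mono-≤ {zero}  f≤g = z≤n
∑-mono-≤ {suc n} f≤g = +-mono-≤ (f≤g zero) (∑-mono-≤ (f≤g ∘ suc))

∑-const : ∀ n c → ∑[ i < n ] c ≡ n * c
∑-const zero    c = refl
∑-const (suc n) c = cong (c +_) (∑-const n c)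

∑-*-∑ : ∀ {k l} (f : Fin k → ℕ) (g : Fin l → ℕ) → sum f * sum g ≡ ∑[ i < k ] ∑[ j < l ] (f i * g j)
∑-*-∑ f g = trans (*-distribʳ-sum (sum g) f) (sum-cong (λ i → *-distribˡ-sum (f i) g))

∑∑-*-∑∑ : ∀ {k l} (f g : Fin k → Fin l → ℕ) →
  (∑[ a < k ] ∑[ b < l ] f a b) * (∑[ c < k ] ∑[ d < l ] g c d)
    ≡ ∑[ a < k ] ∑[ b < l ] ∑[ c < k ] ∑[ d < l ] (f a b * g c d)
∑∑-*-∑∑ {k} {l} f g = begin
  (∑[ a < k ] ∑[ b < l ] f a b) * (∑[ c < k ] ∑[ d < l ] g c d)
    ≡⟨ ∑-*-∑ (λ a → ∑[ b < l ] f a b) (λ c → ∑[ d < l ] g c d) ⟩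
  ∑[ a < k ] ∑[ c < k ] ((∑[ b < l ] f a b) * (∑[ d < l ] g c d))
    ≡⟨ sum-cong (λ a → sum-cong (λ c → ∑-*-∑ (f a) (g c))) ⟩
  ∑[ a < k ] ∑[ c < k ] ∑[ b < l ] ∑[ d < l ] (f a b * g c d)
    ≡⟨ sum-cong (λ a → ∑-comm (λ c b → ∑[ d < l ] (f a b * g c d))) ⟩
  ∑[ a < k ] ∑[ b < l ] ∑[ c < k ] ∑[ d < l ] (f a b * g c d) ∎
  where open ≡-Reasoning

∑-comm⁴ : ∀ {m k l} (F : Fin m → Fin k → Fin l → Fin k → Fin l → ℕ) →
  ∑[ g < m ] ∑[ a < k ] ∑[ b < l ] ∑[ c < k ] ∑[ d < l ] F g a b c d
    ≡ ∑[ a < k ] ∑[ b < l ] ∑[ c < k ] ∑[ d < l ] ∑[ g < m ] F g a b c d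
∑-comm⁴ {_} {k} {l} F =
  trans (∑-comm (λ g a → ∑[ b < l ] ∑[ c < k ] ∑[ d < l ] F g a b c d)) (sum-cong λ a →
  trans (∑-comm (λ g b → ∑[ c < k ] ∑[ d < l ] F g a b c d)) (sum-cong λ b →
  trans (∑-comm (λ g c → ∑[ d < l ] F g a b c d)) (sum-cong λ c →
  ∑-comm (λ g d → F g a b c d))))

∑-reverse³ : ∀ {k l n} (F : Fin k → Fin l → Fin n → ℕ) →
  ∑[ i < k ] ∑[ j < l ] ∑[ h < n ] F i j h ≡ ∑[ h < n ] ∑[ j < l ] ∑[ i < k ] F i j h
∑-reverse³ {k} {l} {n} F = begin
  ∑[ i < k ] ∑[ j < l ] ∑[ h < n ] F i j h  ≡⟨ ∑-comm (λ i j → ∑[ h < n ] F i j h) ⟩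
  ∑[ j < l ] ∑[ i < k ] ∑[ h < n ] F i j h  ≡⟨ sum-cong (λ j → ∑-comm (λ i h → F i j h)) ⟩
  ∑[ j < l ] ∑[ h < n ] ∑[ i < k ] F i j h  ≡⟨ ∑-comm (λ j h → ∑[ i < k ] F i j h) ⟩
  ∑[ h < n ] ∑[ j < l ] ∑[ i < k ] F i j h  ∎
  where open ≡-Reasoning

δ : ∀ {n} → Fin n → Fin n → ℕ
δ x y = 𝟙 ⌊ x ≟ y ⌋

δ-cong : ∀ {k n} {x y : Fin k} {u v : Fin n} → (x ≡ y ⇔ u ≡ v) → δ x y ≡ δ u v
δ-cong {x = x} {y} {u} {v} x≡y⇔u≡v = cong 𝟙 (begin
  ⌊ x ≟ y ⌋     ≡⟨ isYes≗does (x ≟ y) ⟩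
  does (x ≟ y)  ≡⟨ does-⇔ x≡y⇔u≡v (x ≟ y) (u ≟ v) ⟩
  does (u ≟ v)  ≡⟨ isYes≗does (u ≟ v) ⟨
  ⌊ u ≟ v ⌋     ∎)
  where open ≡-Reasoning

δ-sym : ∀ {n} (x y : Fin n) → δ x y ≡ δ y x
δ-sym x y = δ-cong (mk⇔ sym sym)

∑-δ : ∀ {n} (y : Fin n) (f : Fin n → ℕ) → ∑[ x < n ] (δ y x * f x) ≡ f y
∑-δ {suc n} zero    f = begin
  f zero + 0 + ∑[ x < n ] 0  ≡⟨ cong₂ _+_ (+-identityʳ (f zero)) (sum-replicate-zero n) ⟩
  f zero + 0                 ≡⟨ +-identityʳ (f zero) ⟩
  f zero                     ∎
  where open ≡-Reasoning
-- The x = zero summand is 0 * f zero, which vanishes definitionally.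
∑-δ {suc n} (suc y) f = trans
  (sum-cong {n} (λ x → cong (_* f (suc x)) (δ-cong {x = suc y} {suc x} {y} {x} (mk⇔ suc-injective (cong suc)))))
  (∑-δ y (f ∘ suc))

∑-δ-1 : ∀ {n} (y : Fin n) → ∑[ x < n ] δ y x ≡ 1
∑-δ-1 y = trans (sum-cong (λ x → sym (*-identityʳ (δ y x)))) (∑-δ y (λ _ → 1))

module Fibres {k l m} (u : Fin k → Fin l → ℕ) (key : Fin k → Fin l → Fin m) where

  fibre : Fin m → ℕ
  fibre g = ∑[ a < k ] ∑[ b < l ] (u a b * δ (key a b) g)

  ∑-fibre : ∑[ g < m ] fibre g ≡ ∑[ a < k ] ∑[ b < l ] u a b
  ∑-fibre = begin
    ∑[ g < m ] ∑[ a < k ] ∑[ b < l ] (u a b * δ (key a b) g)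
      ≡⟨ trans (∑-comm (λ g a → ∑[ b < l ] (u a b * δ (key a b) g)))
               (sum-cong (λ a → ∑-comm (λ g b → u a b * δ (key a b) g))) ⟩
    ∑[ a < k ] ∑[ b < l ] ∑[ g < m ] (u a b * δ (key a b) g)
      ≡⟨ sum-cong (λ a → sum-cong (λ b → *-distribˡ-sum (u a b) (δ (key a b)))) ⟨
    ∑[ a < k ] ∑[ b < l ] (u a b * ∑[ g < m ] δ (key a b) g)
      ≡⟨ sum-cong (λ a → sum-cong (λ b → trans (cong (u a b *_) (∑-δ-1 (key a b))) (*-identityʳ (u a b)))) ⟩
    ∑[ a < k ] ∑[ b < l ] u a b ∎
    where open ≡-Reasoning

  ∑-fibre² : ∑[ g < m ] (fibre g * fibre g)
    ≡ ∑[ a < k ] ∑[ b < l ] ∑[ c < k ] ∑[ d < l ] (u a b * u c d * δ (key a b) (key c d))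
  ∑-fibre² = begin
    ∑[ g < m ] (fibre g * fibre g)
      ≡⟨ sum-cong (λ g → ∑∑-*-∑∑ (λ a b → u a b * δ (key a b) g) (λ c d → u c d * δ (key c d) g)) ⟩
    ∑[ g < m ] ∑[ a < k ] ∑[ b < l ] ∑[ c < k ] ∑[ d < l ]
      ((u a b * δ (key a b) g) * (u c d * δ (key c d) g))
      ≡⟨ ∑-comm⁴ (λ g a b c d → (u a b * δ (key a b) g) * (u c d * δ (key c d) g)) ⟩
    ∑[ a < k ] ∑[ b < l ] ∑[ c < k ] ∑[ d < l ] ∑[ g < m ]
      ((u a b * δ (key a b) g) * (u c d * δ (key c d) g))
      ≡⟨ sum-cong (λ a → sum-cong (λ b → sum-cong (λ c → sum-cong (λ d → coincidences a b c d)))) ⟩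
    ∑[ a < k ] ∑[ b < l ] ∑[ c < k ] ∑[ d < l ] (u a b * u c d * δ (key a b) (key c d)) ∎
    where
    open ≡-Reasoning
    open +-*-Solver using (solve; _:*_; _:=_)
    coincidences : ∀ a b c d → ∑[ g < m ] ((u a b * δ (key a b) g) * (u c d * δ (key c d) g))
      ≡ u a b * u c d * δ (key a b) (key c d)
    coincidences a b c d = begin
      ∑[ g < m ] ((u a b * δ (key a b) g) * (u c d * δ (key c d) g))
        ≡⟨ sum-cong (λ g → solve 4 (λ x p y q → (x :* p) :* (y :* q) := (x :* y) :* (p :* q))
                                   refl (u a b) (δ (key a b) g) (u c d) (δ (key c d) g)) ⟩
      ∑[ g < m ] (u a b * u c d * (δ (key a b) g * δ (key c d) g))
        ≡⟨ *-distribˡ-sum (u a b * u c d) (λ g → δ (key a b) g * δ (key c d) g) ⟨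
      u a b * u c d * ∑[ g < m ] (δ (key a b) g * δ (key c d) g)
        ≡⟨ cong (u a b * u c d *_) (trans (∑-δ (key a b) (δ (key c d))) (δ-sym (key c d) (key a b))) ⟩
      u a b * u c d * δ (key a b) (key c d) ∎

12[r≡4]+r²≤7r : ∀ r → r ≤ 7 → 12 * 𝟙 ⌊ r N.≟ 4 ⌋ + r * r ≤ 7 * r
12[r≡4]+r²≤7r 0 _ = z≤n
12[r≡4]+r²≤7r 1 _ = ≤ᵇ⇒≤ _ _ tt
12[r≡4]+r²≤7r 2 _ = ≤ᵇ⇒≤ _ _ tt
12[r≡4]+r²≤7r 3 _ = ≤ᵇ⇒≤ _ _ tt
12[r≡4]+r²≤7r 4 _ = ≤ᵇ⇒≤ _ _ tt
12[r≡4]+r²≤7r 5 _ = ≤ᵇ⇒≤ _ _ tt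
12[r≡4]+r²≤7r 6 _ = ≤ᵇ⇒≤ _ _ tt
12[r≡4]+r²≤7r 7 _ = ≤ᵇ⇒≤ _ _ tt
12[r≡4]+r²≤7r (suc (suc (suc (suc (suc (suc (suc (suc _)))))))) (s≤s (s≤s (s≤s (s≤s (s≤s (s≤s (s≤s ())))))))

6d≤d²+9 : ∀ d → 6 * d ≤ d * d + 9
6d≤d²+9 0 = z≤n
6d≤d²+9 1 = ≤ᵇ⇒≤ _ _ tt
6d≤d²+9 2 = ≤ᵇ⇒≤ _ _ tt
6d≤d²+9 3 = ≤ᵇ⇒≤ _ _ tt
6d≤d²+9 4 = ≤ᵇ⇒≤ _ _ tt
6d≤d²+9 5 = ≤ᵇ⇒≤ _ _ tt
6d≤d²+9 d@(suc (suc (suc (suc (suc (suc k)))))) = ≤-trans (*-monoˡ-≤ d (m≤m+n 6 k)) (m≤m+n (d * d) 9)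

∑-completing-square : ∀ {n} (f : Fin n → ℕ) (y : Fin n) →
  6 * sum f + f y * f y ≤ ∑[ x < n ] (f x * f x) + n * 9 + 6 * f y
∑-completing-square {n} f y = begin
  6 * sum f + f y * f y
    ≡⟨ cong₂ _+_ (*-distribˡ-sum 6 f) (sym (∑-δ y (λ x → f x * f x))) ⟩
  ∑[ x < n ] (6 * f x) + ∑[ x < n ] (δ y x * (f x * f x))
    ≡⟨ ∑-distrib-+ (λ x → 6 * f x) (λ x → δ y x * (f x * f x)) ⟨
  ∑[ x < n ] (6 * f x + δ y x * (f x * f x))
    ≤⟨ ∑-mono-≤ (λ x → pointwise ⌊ y ≟ x ⌋ (f x)) ⟩
  ∑[ x < n ] (f x * f x + 9 + δ y x * (6 * f x))
    ≡⟨ ∑-distrib-+ (λ x → f x * f x + 9) (λ x → δ y x * (6 * f x)) ⟩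
  ∑[ x < n ] (f x * f x + 9) + ∑[ x < n ] (δ y x * (6 * f x))
    ≡⟨ cong₂ _+_ (trans (∑-distrib-+ (λ x → f x * f x) (λ _ → 9)) (cong (∑[ x < n ] (f x * f x) +_) (∑-const n 9)))
                 (∑-δ y (λ x → 6 * f x)) ⟩
  ∑[ x < n ] (f x * f x) + n * 9 + 6 * f y ∎
  where
  open ≤-Reasoning
  pointwise : ∀ b d → 6 * d + 𝟙 b * (d * d) ≤ d * d + 9 + 𝟙 b * (6 * d)
  pointwise false d = +-monoˡ-≤ 0 (6d≤d²+9 d)
  pointwise true  d = begin
    6 * d + 1 * (d * d)  ≡⟨ +-comm (6 * d) (1 * (d * d)) ⟩
    1 * (d * d) + 6 * d  ≤⟨ +-mono-≤ (≤-trans (≤-reflexive (*-identityˡ (d * d))) (m≤m+n (d * d) 9))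
                                     (≤-reflexive (sym (*-identityˡ (6 * d)))) ⟩
    d * d + 9 + 1 * (6 * d) ∎

4k≤3m+2n : ∀ {k E N m n} → 12 * k + E ≤ 7 * N → 7 * N ≤ E + m * 9 + 6 * n → 4 * k ≤ 3 * m + 2 * n
4k≤3m+2n {k} {E} {N} {m} {n} h₁ h₂ = *-cancelˡ-≤ 3 (+-cancelʳ-≤ E _ _ (begin
  3 * (4 * k) + E          ≡⟨ cong (_+ E) (*-assoc 3 4 k) ⟨
  12 * k + E               ≤⟨ ≤-trans h₁ h₂ ⟩
  E + m * 9 + 6 * n        ≡⟨ solve 3 (λ E m n → E :+ m :* con 9 :+ con 6 :* n
                                            := con 3 :* (con 3 :* m :+ con 2 :* n) :+ E) refl E m n ⟩
  3 * (3 * m + 2 * n) + E  ∎))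
  where
  open ≤-Reasoning
  open +-*-Solver using (solve; _:+_; _:*_; _:=_; con)

[4k∸3m]²≤28m : ∀ {k m n} → 4 * k ≤ 3 * m + 2 * n → n * n ≤ m * 7 → (4 * k ∸ 3 * m) * (4 * k ∸ 3 * m) ≤ 28 * m
[4k∸3m]²≤28m {k} {m} {n} h₁ h₂ = begin
  (4 * k ∸ 3 * m) * (4 * k ∸ 3 * m)  ≤⟨ *-mono-≤ 4k∸3m≤2n 4k∸3m≤2n ⟩
  2 * n * (2 * n)                    ≡⟨ solve 1 (λ n → con 2 :* n :* (con 2 :* n) := con 4 :* (n :* n)) refl n ⟩
  4 * (n * n)                        ≤⟨ *-monoʳ-≤ 4 h₂ ⟩
  4 * (m * 7)                        ≡⟨ solve 1 (λ m → con 4 :* (m :* con 7) := con 28 :* m) refl m ⟩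
  28 * m                             ∎
  where
  open ≤-Reasoning
  open +-*-Solver using (solve; _:*_; _:=_; con)
  4k∸3m≤2n : 4 * k ∸ 3 * m ≤ 2 * n
  4k∸3m≤2n = ≤-trans (∸-monoˡ-≤ (3 * m) h₁) (≤-reflexive (m+n∸m≡n (3 * m) (2 * n)))

module AdditiveEnergy {m} {_∙_ : Op₂ (Fin m)} {ε : Fin m} {_⁻¹ : Op₁ (Fin m)}
  (G : IsAbelianGroup _≡_ _∙_ ε _⁻¹) (w : Fin m → ℕ) where

  𝔾 : AbelianGroup 0ℓ 0ℓ
  𝔾 = record { isAbelianGroup = G }

  open IsAbelianGroup G using (_-_)
  open AbelianGroupProperties 𝔾 using (//-rightDividesˡ; //-rightDividesʳ; x∙y⁻¹≈ε⇒x≈y; x≈y⇒x∙y⁻¹≈ε)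
  open CommutativeSemigroupProperties (AbelianGroup.commutativeSemigroup 𝔾) using (xy∙z≈xz∙y)

  -≡⇔≡∙ : ∀ {x y z} → x - y ≡ z ⇔ x ≡ z ∙ y
  -≡⇔≡∙ {x} {y} {z} = mk⇔
    (λ x-y≡z → trans (sym (//-rightDividesˡ y x)) (cong (_∙ y) x-y≡z))
    (λ x≡z∙y → trans (cong (_- y) x≡z∙y) (//-rightDividesʳ y z))

  -≡-⇔∙≡∙ : ∀ {p q r s} → p - q ≡ r - s ⇔ p ∙ s ≡ r ∙ q
  -≡-⇔∙≡∙ {p} {q} {r} {s} = begin
    (p - q ≡ r - s)        ≈⟨ -≡⇔≡∙ ⟩
    (p ≡ (r - s) ∙ q)      ≡⟨ cong (p ≡_) (xy∙z≈xz∙y r (s ⁻¹) q) ⟩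
    (p ≡ (r ∙ q) - s)      ≈⟨ mk⇔ sym sym ⟩
    ((r ∙ q) - s ≡ p)      ≈⟨ -≡⇔≡∙ ⟩
    (r ∙ q ≡ p ∙ s)        ≈⟨ mk⇔ sym sym ⟩
    (p ∙ s ≡ r ∙ q)        ∎
    where open SetoidReasoning (⇔-setoid 0ℓ)

  module Sums = Fibres (λ a b → w a * w b) _∙_
  module Differences = Fibres (λ a b → w a * w b) _-_

  rep : Fin m → ℕ
  rep = Sums.fibre

  dif : Fin m → ℕ
  dif = Differences.fibre

  energy : ℕ
  energy = ∑[ a < m ] ∑[ b < m ] ∑[ c < m ] ∑[ d < m ] (w a * w b * (w c * w d) * δ (a ∙ b) (c ∙ d))

  ∑-rep : ∑[ g < m ] rep g ≡ sum w * sum w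
  ∑-rep = trans Sums.∑-fibre (sym (∑-*-∑ w w))

  ∑-dif : ∑[ x < m ] dif x ≡ sum w * sum w
  ∑-dif = trans Differences.∑-fibre (sym (∑-*-∑ w w))

  ∑-rep² : ∑[ g < m ] (rep g * rep g) ≡ energy
  ∑-rep² = Sums.∑-fibre²

  ∑-dif² : ∑[ x < m ] (dif x * dif x) ≡ energy
  -- (p, q, r, s) ↦ (p, s, r, q) turns p - q = r - s into the additive quadruple p + s = r + q.
  ∑-dif² = begin
    ∑[ x < m ] (dif x * dif x)
      ≡⟨ Differences.∑-fibre² ⟩
    ∑[ p < m ] ∑[ q < m ] ∑[ r < m ] ∑[ s < m ] (w p * w q * (w r * w s) * δ (p - q) (r - s))
      ≡⟨ sum-cong (λ p → sum-cong (λ q → sum-cong (λ r → sum-cong (λ s → quadruple p q r s)))) ⟩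
    ∑[ p < m ] ∑[ q < m ] ∑[ r < m ] ∑[ s < m ] (w p * w s * (w r * w q) * δ (p ∙ s) (r ∙ q))
      ≡⟨ sum-cong (λ p → ∑-reverse³ (λ q r s → w p * w s * (w r * w q) * δ (p ∙ s) (r ∙ q))) ⟩
    energy ∎
    where
    open ≡-Reasoning
    open +-*-Solver using (solve; _:*_; _:=_)
    quadruple : ∀ p q r s → w p * w q * (w r * w s) * δ (p - q) (r - s)
      ≡ w p * w s * (w r * w q) * δ (p ∙ s) (r ∙ q)
    quadruple p q r s = cong₂ _*_
      (solve 4 (λ a b c d → a :* b :* (c :* d) := a :* d :* (c :* b)) refl (w p) (w q) (w r) (w s))
      (δ-cong -≡-⇔∙≡∙)

  dif-ε : dif ε ≡ ∑[ a < m ] (w a * w a)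
  dif-ε = begin
    ∑[ p < m ] ∑[ q < m ] (w p * w q * δ (p - q) ε)
      ≡⟨ sum-cong (λ p → sum-cong (λ q → diagonal p q)) ⟩
    ∑[ p < m ] ∑[ q < m ] (w p * (δ p q * w q))
      ≡⟨ sum-cong (λ p → trans (sym (*-distribˡ-sum (w p) (λ q → δ p q * w q))) (cong (w p *_) (∑-δ p w))) ⟩
    ∑[ p < m ] (w p * w p) ∎
    where
    open ≡-Reasoning
    diagonal : ∀ p q → w p * w q * δ (p - q) ε ≡ w p * (δ p q * w q)
    diagonal p q = begin
      w p * w q * δ (p - q) ε  ≡⟨ cong (w p * w q *_) (δ-cong (mk⇔ (x∙y⁻¹≈ε⇒x≈y p q) x≈y⇒x∙y⁻¹≈ε)) ⟩
      w p * w q * δ p q        ≡⟨ *-assoc (w p) (w q) (δ p q) ⟩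
      w p * (w q * δ p q)      ≡⟨ cong (w p *_) (*-comm (w q) (δ p q)) ⟩
      w p * (δ p q * w q)      ∎

  fours-bound : (∀ g → rep g ≤ 7) → 12 * ∑[ g < m ] 𝟙 ⌊ rep g N.≟ 4 ⌋ + energy ≤ 7 * (sum w * sum w)
  fours-bound rep≤7 = begin
    12 * ∑[ g < m ] 𝟙 ⌊ rep g N.≟ 4 ⌋ + energy
      ≡⟨ cong₂ _+_ (*-distribˡ-sum 12 (λ g → 𝟙 ⌊ rep g N.≟ 4 ⌋)) (sym ∑-rep²) ⟩
    ∑[ g < m ] (12 * 𝟙 ⌊ rep g N.≟ 4 ⌋) + ∑[ g < m ] (rep g * rep g)
      ≡⟨ ∑-distrib-+ (λ g → 12 * 𝟙 ⌊ rep g N.≟ 4 ⌋) (λ g → rep g * rep g) ⟨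
    ∑[ g < m ] (12 * 𝟙 ⌊ rep g N.≟ 4 ⌋ + rep g * rep g)
      ≤⟨ ∑-mono-≤ (λ g → 12[r≡4]+r²≤7r (rep g) (rep≤7 g)) ⟩
    ∑[ g < m ] (7 * rep g)
      ≡⟨ *-distribˡ-sum 7 rep ⟨
    7 * ∑[ g < m ] rep g
      ≡⟨ cong (7 *_) ∑-rep ⟩
    7 * (sum w * sum w) ∎
    where open ≤-Reasoning

  energy-bound : 6 * (sum w * sum w) + ∑[ a < m ] (w a * w a) * ∑[ a < m ] (w a * w a)
    ≤ energy + m * 9 + 6 * ∑[ a < m ] (w a * w a)
  energy-bound = begin
    6 * (sum w * sum w) + ∑[ a < m ] (w a * w a) * ∑[ a < m ] (w a * w a)
      ≡⟨ cong₂ (λ s t → 6 * s + t * t) ∑-dif dif-ε ⟨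
    6 * ∑[ x < m ] dif x + dif ε * dif ε
      ≤⟨ ∑-completing-square dif ε ⟩
    ∑[ x < m ] (dif x * dif x) + m * 9 + 6 * dif ε
      ≡⟨ cong₂ (λ s t → s + m * 9 + 6 * t) ∑-dif² dif-ε ⟩
    energy + m * 9 + 6 * ∑[ a < m ] (w a * w a) ∎
    where open ≤-Reasoning

module SubsetEnergy {m} {_⊕_ : Op₂ (Fin m)} {e : Fin m} {inv : Op₁ (Fin m)}
  (G : IsAbelianGroup _≡_ _⊕_ e inv) (A : Subset m) where

  α : Fin m → ℕ
  α = 𝟙 ∘ lookup A

  open AdditiveEnergy G α

  n : ℕ
  n = sum α

  ∑α²≡n : ∑[ a < m ] (α a * α a) ≡ n
  ∑α²≡n = sum-cong (𝟙-idem ∘ lookup A)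

  R≡rep : ∀ g → R _⊕_ A g ≡ rep g
  R≡rep g = begin
    sumFin (λ a → count (λ b → lookup A a ∧ lookup A b ∧ ⌊ (a ⊕ b) ≟ g ⌋))
      ≡⟨ sumFin≡sum (λ a → count (λ b → lookup A a ∧ lookup A b ∧ ⌊ (a ⊕ b) ≟ g ⌋)) ⟩
    ∑[ a < m ] count (λ b → lookup A a ∧ lookup A b ∧ ⌊ (a ⊕ b) ≟ g ⌋)
      ≡⟨ sum-cong (λ a → count≡∑𝟙 (λ b → lookup A a ∧ lookup A b ∧ ⌊ (a ⊕ b) ≟ g ⌋)) ⟩
    ∑[ a < m ] ∑[ b < m ] 𝟙 (lookup A a ∧ lookup A b ∧ ⌊ (a ⊕ b) ≟ g ⌋)
      ≡⟨ sum-cong (λ a → sum-cong (λ b → 𝟙-∧∧ (lookup A a) (lookup A b) ⌊ (a ⊕ b) ≟ g ⌋)) ⟩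
    rep g ∎
    where
    open ≡-Reasoning
    𝟙-∧∧ : ∀ x y z → 𝟙 (x ∧ y ∧ z) ≡ 𝟙 x * 𝟙 y * 𝟙 z
    𝟙-∧∧ x y z = trans (𝟙-∧ x (y ∧ z)) (trans (cong (𝟙 x *_) (𝟙-∧ y z)) (sym (*-assoc (𝟙 x) (𝟙 y) (𝟙 z))))

  count-R≡4-bound : (∀ g → R _⊕_ A g ≤ 7) →
    (4 * count (λ g → ⌊ R _⊕_ A g N.≟ 4 ⌋) ∸ 3 * m) * (4 * count (λ g → ⌊ R _⊕_ A g N.≟ 4 ⌋) ∸ 3 * m) ≤ 28 * m
  count-R≡4-bound R≤7 =
    [4k∸3m]²≤28m {k} {m} {n} (4k≤3m+2n {k} {energy} {n * n} {m} {n} 12k+E≤7n² 7n²≤E+9m+6n) n²≤7m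
    where
    open ≤-Reasoning

    k : ℕ
    k = count (λ g → ⌊ R _⊕_ A g N.≟ 4 ⌋)

    rep≤7 : ∀ g → rep g ≤ 7
    rep≤7 g = ≤-trans (≤-reflexive (sym (R≡rep g))) (R≤7 g)

    12k+E≤7n² : 12 * k + energy ≤ 7 * (n * n)
    12k+E≤7n² = begin
      12 * k + energy
        ≡⟨ cong (λ t → 12 * t + energy) (count≡∑𝟙 (λ g → ⌊ R _⊕_ A g N.≟ 4 ⌋)) ⟩
      12 * ∑[ g < m ] 𝟙 ⌊ R _⊕_ A g N.≟ 4 ⌋ + energy
        ≡⟨ cong (λ t → 12 * t + energy) (sum-cong (λ g → cong (λ r → 𝟙 ⌊ r N.≟ 4 ⌋) (R≡rep g))) ⟩
      12 * ∑[ g < m ] 𝟙 ⌊ rep g N.≟ 4 ⌋ + energy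
        ≤⟨ fours-bound rep≤7 ⟩
      7 * (n * n) ∎

    7n²≤E+9m+6n : 7 * (n * n) ≤ energy + m * 9 + 6 * n
    7n²≤E+9m+6n = begin
      7 * (n * n)                  ≡⟨ +-comm (n * n) (6 * (n * n)) ⟩
      6 * (n * n) + n * n          ≡⟨ cong (λ t → 6 * (n * n) + t * t) ∑α²≡n ⟨
      6 * (n * n) + ∑[ a < m ] (α a * α a) * ∑[ a < m ] (α a * α a)
                                   ≤⟨ energy-bound ⟩
      energy + m * 9 + 6 * ∑[ a < m ] (α a * α a)
                                   ≡⟨ cong (λ t → energy + m * 9 + 6 * t) ∑α²≡n ⟩
      energy + m * 9 + 6 * n       ∎

    n²≤7m : n * n ≤ m * 7
    n²≤7m = begin
      n * n                 ≡⟨ ∑-rep ⟨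
      ∑[ g < m ] rep g      ≤⟨ ∑-mono-≤ rep≤7 ⟩
      ∑[ g < m ] 7          ≡⟨ ∑-const m 7 ⟩
      m * 7                 ∎

theorem1p3 : Σ ℕ λ C → 1 ≤ C ×
    ((m : ℕ) (_⊕_ : Op₂ (Fin m)) (e : Fin m) (inv : Op₁ (Fin m)) →
     IsAbelianGroup _≡_ _⊕_ e inv →
     (A : Subset m) →
     ((g : Fin m) → R _⊕_ A g ≤ 7) →
     ((4 * count (λ g → ⌊ R _⊕_ A g N.≟ 4 ⌋)) ∸ (3 * m)) * ((4 * count (λ g → ⌊ R _⊕_ A g N.≟ 4 ⌋)) ∸ (3 * m))
       ≤ 16 * C * C * m)
theorem1p3 = 2 , s≤s z≤n , λ m _⊕_ e inv G A R≤7 →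
  ≤-trans (SubsetEnergy.count-R≡4-bound G A R≤7) (*-monoˡ-≤ m (≤ᵇ⇒≤ 28 64 tt))
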